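{- Let $N$ be a normal shape and $\tau\in SYT(N)$. Let $u=(u_1,u_2)$ and $v=(v_1,v_2)$ be distinct cells of $N$ with $u_1>v_1$ and $u_2<v_2$, and let $w=(w_1,w_2)\in N$. Then: (1) if $\{u,v\}\in E(Tb(\tau))$, $w_1\le u_1$, $w_2\le u_2$ and $w_1>v_1$, then $\{w,v\}\in E(Tb(\tau))$; (2) if $\{u,v\}\in E(Tb(\tau))$, $w_1\ge v_1$, $w_2\ge v_2$ and $w_1<u_1$, then $\{u,w\}\in E(Tb(\tau))$.
   Context: Cells $(i,j)\in\mathbb{Z}^2$: row $i$ (numbered top to bottom), column $j$ (left to right); $\mathbb{N}^2=\{(i,j):i,j\ge1\}$. For finite $S\subseteq\mathbb{Z}^2$, $SYT(S)$ is the set of bijections $\tau:S\to\{1,\dots,|S|\}$ with $\tau(i,j)<\tau(i,j+1)$ and $\tau(i,j)<\tau(i+1,j)$ whenever the two cells involved lie in $S$. A finite $N\subseteq\mathbb{N}^2$ is normal if it is connected (any two cells joined by a path in $N$ with steps $(\pm1,0),(0,\pm1)$) and $N=\mathrm{conv}(N)\cap\mathbb{N}^2$, the convex hull taken in $\mathbb{R}^2$. The tableau graph $Tb(\tau)$ of $\tau\in SYT(S)$ has vertex set $S$ and edge set $E(Tb(\tau))$ consisting of the pairs $\{(i_1,j_1),(i_2,j_2)\}\subseteq S$ with $i_1>i_2$, $j_1<j_2$ and $\tau(i_1,j_1)<\tau(i_2,j_2)$. -}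

module Defs where

open import Data.Nat using (ℕ; zero; suc; _+_; _*_; _≤_; _<_; _>_; _≥_)
open import Data.Product using (Σ; ∃; _×_; _,_; proj₁; proj₂)
open import Data.Sum using (_⊎_)
open import Data.List using (List; []; _∷_; length; map)
open import Data.Nat.ListAction using (sum)
open import Data.List.Membership.Propositional using (_∈_)
open import Data.List.Relation.Unary.All using (All)
open import Data.List.Relation.Unary.Unique.Propositional using (Unique)
open import Relation.Binary.PropositionalEquality using (_≡_)
open import Relation.Nullary using (¬_)

-- A cell (i , j): row i, column j.  All cells of interest lie in N²,
-- so natural-number coordinates suffice.
Cell : Set
Cell = ℕ × ℕ

row col : Cell → ℕ
row = proj₁
col = proj₂

-- A finite set of cells, given as a duplicate-free list.
Shape : Set
Shape = List Cell

-- (i , j) ∈ ℕ² in the paper's sense: i , j ≥ 1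
InN² : Cell → Set
InN² c = 1 ≤ row c × 1 ≤ col c

Adjacent : Cell → Cell → Set
Adjacent (i , j) (i' , j') =
  (i ≡ i' × (suc j ≡ j' ⊎ j ≡ suc j')) ⊎ (j ≡ j' × (suc i ≡ i' ⊎ i ≡ suc i'))

data Path (N : Shape) : Cell → Cell → Set where
  here : ∀ {a} → a ∈ N → Path N a a
  step : ∀ {a c b} → a ∈ N → Adjacent a c → Path N c b → Path N a b

Connected : Shape → Set
Connected N = ∀ {a b} → a ∈ N → b ∈ N → Path N a b

-- Since p and all cells of N are
-- lattice points, p ∈ conv(N) iff p is a convex combination of cells of N
-- with rational weights; clearing denominators: there is a nonempty list
-- (multiset) xs of cells of N whose coordinate sums are length xs times p.
InHull : Shape → Cell → Set
InHull N p = Σ (List Cell) λ xs →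
  1 ≤ length xs × All (_∈ N) xs ×
  sum (map row xs) ≡ length xs * row p ×
  sum (map col xs) ≡ length xs * col p

-- N is normal: finite subset of ℕ², connected, and N = conv(N) ∩ ℕ²
-- (the inclusion N ⊆ conv(N) is automatic).
Normal : Shape → Set
Normal N = Unique N × All InN² N × Connected N ×
  (∀ p → InN² p → InHull N p → p ∈ N)

SYT : Shape → (Cell → ℕ) → Set
SYT N τ =
  (∀ {c} → c ∈ N → 1 ≤ τ c × τ c ≤ length N) ×
  (∀ {c d} → c ∈ N → d ∈ N → τ c ≡ τ d → c ≡ d) ×
  (∀ k → 1 ≤ k → k ≤ length N → ∃ λ c → c ∈ N × τ c ≡ k) ×
  (∀ {i j} → (i , j) ∈ N → (i , suc j) ∈ N → τ (i , j) < τ (i , suc j)) ×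
  (∀ {i j} → (i , j) ∈ N → (suc i , j) ∈ N → τ (i , j) < τ (suc i , j))

EdgeDir : (Cell → ℕ) → Cell → Cell → Set
EdgeDir τ x y = row x > row y × col x < col y × τ x < τ y

TbEdge : Shape → (Cell → ℕ) → Cell → Cell → Set
TbEdge N τ x y = x ∈ N × y ∈ N × (EdgeDir τ x y ⊎ EdgeDir τ y x)

module Submission where

-- Within a normal shape, a cell lying between two cells of the same row (or column)
-- is a barycentre of them, hence belongs to the shape. Combined with connectedness,
-- this gives: if w ≠ u are cells of N with u weakly below-right of w, then the cell
-- directly below or directly right of w lies in N. Following such steps, along
-- which τ increases, shows that τ is monotone for the componentwise order on N;
-- both claims then follow from τ u < τ v.

open import Defs
open import Data.Nat using (ℕ; zero; suc; _+_; _*_; _≤_; _<_; _>_; _≥_; s≤s; z≤n; z<s)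
open import Data.Nat.Properties
open import Data.Nat.ListAction using (sum)
open import Data.Product using (_×_; _,_; proj₁; proj₂)
open import Data.Product.Properties using (×-≡,≡→≡)
open import Data.Sum using (_⊎_; inj₁; inj₂)
open import Data.List using (_∷_; length; map; replicate)
open import Data.List.Properties using (length-replicate; map-replicate)
open import Data.List.Membership.Propositional using (_∈_)
open import Data.List.Relation.Unary.All as All using (_∷_)
open import Data.List.Relation.Unary.All.Properties using (replicate⁺)
open import Relation.Binary.PropositionalEquality
open import Relation.Nullary using (¬_)
open import Data.Empty using (⊥-elim)

sum-replicate : ∀ k n → sum (replicate k n) ≡ k * n
sum-replicate zero    n = refl
sum-replicate (suc k) n = cong (n +_) (sum-replicate k n)

sum-map-replicate : ∀ {A : Set} (f : A → ℕ) k c → sum (map f (replicate k c)) ≡ k * f c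
sum-map-replicate f k c = trans (cong sum (map-replicate f k c)) (sum-replicate k (f c))

+≡⇒≤ : ∀ {m k n} → m + k ≡ n → m ≤ n
+≡⇒≤ {m} {k} refl = m≤m+n m k

+-suc≡⇒< : ∀ {m k n} → m + suc k ≡ n → m < n
+-suc≡⇒< {m} refl = m<m+n m z<s

shifted-mean : ∀ j k → suc k * suc j ≡ (suc j + k) + k * j
shifted-mean j k = trans (cong (suc j +_) (*-suc k j)) (sym (+-assoc (suc j) k (k * j)))

path-head-∈ : ∀ {N a b} → Path N a b → a ∈ N
path-head-∈ (here a∈N)     = a∈N
path-head-∈ (step a∈N _ _) = a∈N

_⊏_ : Cell → Cell → Set
(i , j) ⊏ (a , b) = i ≤ a × j ≤ b × (i < a ⊎ j < b)

⊏-irrefl : ∀ {w} → ¬ (w ⊏ w)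
⊏-irrefl (_ , _ , inj₁ i<i) = <-irrefl refl i<i
⊏-irrefl (_ , _ , inj₂ j<j) = <-irrefl refl j<j

adjacent-⊏ : ∀ {i j} x c → Adjacent x c → i < row c → j < col c → (i , j) ⊏ x
adjacent-⊏ _ _ (inj₁ (refl , inj₁ refl)) i<a (s≤s j<b) = <⇒≤ i<a , j<b , inj₁ i<a
adjacent-⊏ _ _ (inj₁ (refl , inj₂ refl)) i<a j<b       = <⇒≤ i<a , <⇒≤ (m<n⇒m<1+n j<b) , inj₁ i<a
adjacent-⊏ _ _ (inj₂ (refl , inj₁ refl)) (s≤s i<a) j<b = i<a , <⇒≤ j<b , inj₂ j<b
adjacent-⊏ _ _ (inj₂ (refl , inj₂ refl)) i<a j<b       = <⇒≤ (m<n⇒m<1+n i<a) , <⇒≤ j<b , inj₂ j<b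

⊏-split : ∀ {i j a b} → (i , j) ⊏ (a , b) →
  (a ≡ i × j < b) ⊎ (b ≡ j × i < a) ⊎ (i < a × j < b)
⊏-split (i≤a , j≤b , strict) with m≤n⇒m<n∨m≡n i≤a | m≤n⇒m<n∨m≡n j≤b | strict
... | inj₂ refl | _         | inj₁ i<i = ⊥-elim (<-irrefl refl i<i)
... | inj₂ refl | _         | inj₂ j<b = inj₁ (refl , j<b)
... | inj₁ _    | inj₂ refl | inj₂ j<j = ⊥-elim (<-irrefl refl j<j)
... | inj₁ i<a  | inj₂ refl | inj₁ _   = inj₂ (inj₁ (refl , i<a))
... | inj₁ i<a  | inj₁ j<b  | _        = inj₂ (inj₂ (i<a , j<b))

module _ {N : Shape} (normal : Normal N) where

  private
    ∈⇒InN² : ∀ {c} → c ∈ N → InN² c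
    ∈⇒InN² = All.lookup (proj₁ (proj₂ normal))

    connected : Connected N
    connected = proj₁ (proj₂ (proj₂ normal))

    hull-closed : ∀ p → InN² p → InHull N p → p ∈ N
    hull-closed = proj₂ (proj₂ (proj₂ normal))

  barycentre-∈ : ∀ {c y} p k → InN² p → c ∈ N → y ∈ N →
    suc k * row p ≡ row y + k * row c → suc k * col p ≡ col y + k * col c → p ∈ N
  barycentre-∈ {c} {y} p k p∈ℕ² c∈N y∈N rows cols =
    hull-closed p p∈ℕ² (y ∷ replicate k c , s≤s z≤n , y∈N ∷ replicate⁺ k c∈N ,
      weights row rows , weights col cols)
    where
    weights : ∀ f → suc k * f p ≡ f y + k * f c →
      f y + sum (map f (replicate k c)) ≡ suc (length (replicate k c)) * f p
    weights f eq rewrite sum-map-replicate f k c | length-replicate k {c} = sym eq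

  ∈-right : ∀ {i j y} → (i , j) ∈ N → y ∈ N → row y ≡ i → j < col y → (i , suc j) ∈ N
  ∈-right {i} {j} {_ , _} ij∈N y∈N refl j<b with m≤n⇒∃[o]m+o≡n j<b
  ... | k , refl = barycentre-∈ (i , suc j) k (proj₁ (∈⇒InN² ij∈N) , s≤s z≤n) ij∈N y∈N
    refl (shifted-mean j k)

  ∈-below : ∀ {i j y} → (i , j) ∈ N → y ∈ N → col y ≡ j → i < row y → (suc i , j) ∈ N
  ∈-below {i} {j} {_ , _} ij∈N y∈N refl i<a with m≤n⇒∃[o]m+o≡n i<a
  ... | k , refl = barycentre-∈ (suc i , j) k (s≤s z≤n , proj₂ (∈⇒InN² ij∈N)) ij∈N y∈N
    (shifted-mean i k) refl

  -- Walking back along a path that ends strictly below-right of w, the first cell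
  -- to reach w's row or column forces a neighbour of w into N by convexity.
  path-exits : ∀ {i j} → (i , j) ∈ N → ∀ {x c} → Path N x c → (i , j) ⊏ c →
    ((suc i , j) ∈ N ⊎ (i , suc j) ∈ N) ⊎ (i , j) ⊏ x
  path-exits w∈N (here _) w⊏x = inj₂ w⊏x
  path-exits w∈N (step {x} {c} _ x~c path) w⊏u with path-exits w∈N path w⊏u
  ... | inj₁ exit = inj₁ exit
  ... | inj₂ w⊏c with ⊏-split w⊏c
  ...   | inj₁ (row≡ , j<b)        = inj₁ (inj₂ (∈-right w∈N (path-head-∈ path) row≡ j<b))
  ...   | inj₂ (inj₁ (col≡ , i<a)) = inj₁ (inj₁ (∈-below w∈N (path-head-∈ path) col≡ i<a))
  ...   | inj₂ (inj₂ (i<a , j<b))  = inj₂ (adjacent-⊏ x c x~c i<a j<b)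

  outer-neighbour-∈ : ∀ {i j u} → (i , j) ∈ N → u ∈ N → (i , j) ⊏ u →
    (suc i , j) ∈ N ⊎ (i , suc j) ∈ N
  outer-neighbour-∈ w∈N u∈N w⊏u with path-exits w∈N (connected w∈N u∈N) w⊏u
  ... | inj₁ exit = exit
  ... | inj₂ w⊏w  = ⊥-elim (⊏-irrefl w⊏w)

  module _ {τ : Cell → ℕ} (syt : SYT N τ) where

    private
      τ-right : ∀ {i j} → (i , j) ∈ N → (i , suc j) ∈ N → τ (i , j) < τ (i , suc j)
      τ-right = proj₁ (proj₂ (proj₂ (proj₂ syt)))

      τ-below : ∀ {i j} → (i , j) ∈ N → (suc i , j) ∈ N → τ (i , j) < τ (suc i , j)
      τ-below = proj₂ (proj₂ (proj₂ (proj₂ syt)))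

    τ-mono-offset : ∀ d₁ d₂ {w u} → w ∈ N → u ∈ N →
      row w + d₁ ≡ row u → col w + d₂ ≡ col u → τ w ≤ τ u
    τ-mono-offset zero zero {i , j} _ _ r c =
      ≤-reflexive (cong τ (×-≡,≡→≡ (trans (sym (+-identityʳ i)) r , trans (sym (+-identityʳ j)) c)))
    τ-mono-offset (suc a) zero {i , j} w∈N u∈N r c =
      ≤-trans (<⇒≤ (τ-below w∈N below∈N)) (τ-mono-offset a zero below∈N u∈N (trans (sym (+-suc i a)) r) c)
      where below∈N = ∈-below w∈N u∈N (trans (sym c) (+-identityʳ j)) (+-suc≡⇒< r)
    τ-mono-offset zero (suc b) {i , j} w∈N u∈N r c =
      ≤-trans (<⇒≤ (τ-right w∈N right∈N)) (τ-mono-offset zero b right∈N u∈N r (trans (sym (+-suc j b)) c))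
      where right∈N = ∈-right w∈N u∈N (trans (sym r) (+-identityʳ i)) (+-suc≡⇒< c)
    τ-mono-offset (suc a) (suc b) {i , j} w∈N u∈N r c
      with outer-neighbour-∈ w∈N u∈N (+≡⇒≤ r , +≡⇒≤ c , inj₁ (+-suc≡⇒< r))
    ... | inj₁ below∈N =
      ≤-trans (<⇒≤ (τ-below w∈N below∈N)) (τ-mono-offset a (suc b) below∈N u∈N (trans (sym (+-suc i a)) r) c)
    ... | inj₂ right∈N =
      ≤-trans (<⇒≤ (τ-right w∈N right∈N)) (τ-mono-offset (suc a) b right∈N u∈N r (trans (sym (+-suc j b)) c))

    τ-mono : ∀ {w u} → w ∈ N → u ∈ N → row w ≤ row u → col w ≤ col u → τ w ≤ τ u
    τ-mono w∈N u∈N r≤ c≤ with m≤n⇒∃[o]m+o≡n r≤ | m≤n⇒∃[o]m+o≡n c≤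
    ... | d₁ , r | d₂ , c = τ-mono-offset d₁ d₂ w∈N u∈N r c

lemma1 : (N : Shape) (τ : Cell → ℕ) → Normal N → SYT N τ →
    (u v w : Cell) → u ∈ N → v ∈ N → ¬ (u ≡ v) →
    row u > row v → col u < col v → w ∈ N →
    (TbEdge N τ u v → row w ≤ row u → col w ≤ col u → row w > row v →
       TbEdge N τ w v) ×
    (TbEdge N τ u v → row w ≥ row v → col w ≥ col v → row w < row u →
       TbEdge N τ u w)
lemma1 N τ normal syt u v w u∈N v∈N _ u₁>v₁ u₂<v₂ w∈N = below-left , above-right
  where
  τu<τv : TbEdge N τ u v → τ u < τ v
  τu<τv (_ , _ , inj₁ (_ , _ , τu<τv)) = τu<τv
  τu<τv (_ , _ , inj₂ (v₁>u₁ , _ , _)) = ⊥-elim (<-asym v₁>u₁ u₁>v₁)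

  below-left : TbEdge N τ u v → row w ≤ row u → col w ≤ col u → row w > row v → TbEdge N τ w v
  below-left uv w₁≤u₁ w₂≤u₂ w₁>v₁ = w∈N , v∈N , inj₁ (w₁>v₁ , ≤-<-trans w₂≤u₂ u₂<v₂ ,
    ≤-<-trans (τ-mono normal syt w∈N u∈N w₁≤u₁ w₂≤u₂) (τu<τv uv))

  above-right : TbEdge N τ u v → row w ≥ row v → col w ≥ col v → row w < row u → TbEdge N τ u w
  above-right uv w₁≥v₁ w₂≥v₂ w₁<u₁ = u∈N , w∈N , inj₁ (w₁<u₁ , <-≤-trans u₂<v₂ w₂≥v₂ ,
    <-≤-trans (τu<τv uv) (τ-mono normal syt v∈N w∈N w₁≥v₁ w₂≥v₂))
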